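{- Let $\mathbb{F}$ be a finite field with $q$ elements, $\mathbb{M}$ the group of complex characters of $\mathbb{F}^*$, and $\mathbb{J}(\alpha,\beta) = \frac{1}{q-1}\sum_{x+y=1,\ x,y\in\mathbb{F}^*} \alpha(x)\beta(y)$ for $\alpha,\beta \in \mathbb{M}$. Then for all $\alpha_1,\alpha_2,\alpha_3,\alpha_4 \in \mathbb{M}$, \[ \sum_{\beta \in \mathbb{M}} \mathbb{J}(\alpha_1 \beta, \alpha_2 \beta^{ -1}) \mathbb{J}(\alpha_3 \beta, \alpha_4 \beta^{ -1}) = \mathbb{J}(\alpha_1 \alpha_4, \alpha_2 \alpha_3). \]
   Context: Characters are evaluated only on $\mathbb{F}^*$; the Jacobi sum is defined by the displayed formula for all pairs of characters, including trivial ones. -}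

module Defs where

open import Level using (Level; _⊔_) renaming (suc to lsuc)
open import Algebra.Bundles using (CommutativeRing)
open import Data.Nat using (ℕ; zero; suc; _∸_)
open import Data.Fin using (Fin; toℕ) renaming (zero to fzero; suc to fsuc)
open import Data.Product using (Σ; ∃; _,_; proj₁; proj₂)
open import Relation.Nullary using (¬_; Dec; yes; no)
open import Relation.Binary using (Decidable)
open import Relation.Binary.PropositionalEquality using (_≡_; refl; cong)
import Relation.Binary.Reasoning.Setoid as SetoidReasoning

module RingOps {c ℓ : Level} (R : CommutativeRing c ℓ) where
  open CommutativeRing R

  ofℕ : ℕ → Carrier
  ofℕ zero    = 0#
  ofℕ (suc n) = 1# + ofℕ n

  pow : Carrier → ℕ → Carrier
  pow x zero    = 1#
  pow x (suc n) = x * pow x n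

  ∑ : (n : ℕ) → (Fin n → Carrier) → Carrier
  ∑ zero    f = 0#
  ∑ (suc n) f = f fzero + ∑ n (λ i → f (fsuc i))

record FiniteField (c ℓ : Level) : Set (lsuc (c ⊔ ℓ)) where
  field
    cring : CommutativeRing c ℓ
  open CommutativeRing cring
  field
    0≉1      : ¬ (0# ≈ 1#)
    inverse  : ∀ x → ¬ (x ≈ 0#) → ∃ λ y → x * y ≈ 1#
    _≟_      : Decidable _≈_
    q        : ℕ
    enum     : Fin q → Carrier
    enum-inj : ∀ i j → enum i ≈ enum j → i ≡ j
    enum-surj : ∀ x → ∃ λ i → enum i ≈ x

-- An algebraically closed field of characteristic 0 (the role of ℂ).

record ACF₀ (c ℓ : Level) : Set (lsuc (c ⊔ ℓ)) where
  field
    cring : CommutativeRing c ℓ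
  open CommutativeRing cring
  open RingOps cring
  field
    0≉1     : ¬ (0# ≈ 1#)
    inverse : ∀ x → ¬ (x ≈ 0#) → ∃ λ y → x * y ≈ 1#
    char0   : ∀ n → ¬ (ofℕ (suc n) ≈ 0#)
    algClosed : ∀ n (a : Fin (suc n) → Carrier) →
                ∃ λ x → pow x (suc n) + ∑ (suc n) (λ i → a i * pow x (toℕ i)) ≈ 0#

module Characters {c ℓ c' ℓ' : Level} (𝔽 : FiniteField c ℓ) (𝕂 : ACF₀ c' ℓ') where
  module F = FiniteField 𝔽
  module FR = CommutativeRing F.cring
  module K = ACF₀ 𝕂
  module KR = CommutativeRing K.cring
  open RingOps K.cring

  F* : Set (c ⊔ ℓ)
  F* = Σ FR.Carrier (λ x → ¬ (x FR.≈ FR.0#))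

  private
    nz-mul : ∀ {x y} → ¬ (x FR.≈ FR.0#) → ¬ (y FR.≈ FR.0#) → ¬ ((x FR.* y) FR.≈ FR.0#)
    nz-mul {x} {y} x≉0 y≉0 xy≈0 = x≉0 x≈0
      where
      open SetoidReasoning FR.setoid
      y' = proj₁ (F.inverse y y≉0)
      yy'≈1 = proj₂ (F.inverse y y≉0)
      x≈0 : x FR.≈ FR.0#
      x≈0 = begin
        x                    ≈⟨ FR.sym (FR.*-identityʳ x) ⟩
        x FR.* FR.1#         ≈⟨ FR.*-congˡ (FR.sym yy'≈1) ⟩
        x FR.* (y FR.* y')   ≈⟨ FR.sym (FR.*-assoc x y y') ⟩
        (x FR.* y) FR.* y'   ≈⟨ FR.*-congʳ xy≈0 ⟩
        FR.0# FR.* y'        ≈⟨ FR.zeroˡ y' ⟩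
        FR.0# ∎

    nz-inv : ∀ x (p : ¬ (x FR.≈ FR.0#)) → ¬ (proj₁ (F.inverse x p) FR.≈ FR.0#)
    nz-inv x p y≈0 = F.0≉1 (FR.trans (FR.sym (FR.zeroʳ x))
                             (FR.trans (FR.*-congˡ (FR.sym y≈0)) (proj₂ (F.inverse x p))))

  1* : F*
  1* = FR.1# , λ e → F.0≉1 (FR.sym e)

  _·*_ : F* → F* → F*
  (x , p) ·* (y , r) = x FR.* y , nz-mul p r

  _⁻¹* : F* → F*
  (x , p) ⁻¹* = proj₁ (F.inverse x p) , nz-inv x p

  record Character : Set (c ⊔ ℓ ⊔ c' ⊔ ℓ') where
    field
      χ      : F* → KR.Carrier
      χ-cong : ∀ x y → proj₁ x FR.≈ proj₁ y → χ x KR.≈ χ y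
      χ-one  : χ 1* KR.≈ KR.1#
      χ-mul  : ∀ x y → χ (x ·* y) KR.≈ (χ x KR.* χ y)
  open Character public

  _⊗_ : (F* → KR.Carrier) → (F* → KR.Carrier) → (F* → KR.Carrier)
  (α ⊗ β) x = α x KR.* β x

  inv : (F* → KR.Carrier) → (F* → KR.Carrier)
  inv β x = β (x ⁻¹*)

  private
    q-1≉0' : (n : ℕ) (i j : Fin n) → ¬ (i ≡ j) → ¬ (ofℕ (n ∸ 1) KR.≈ KR.0#)
    q-1≉0' (suc zero) fzero fzero i≢j _ = i≢j refl
    q-1≉0' (suc (suc k)) i j i≢j = K.char0 k

  q-1≉0 : ¬ (ofℕ (F.q ∸ 1) KR.≈ KR.0#)
  q-1≉0 = q-1≉0' F.q i₀ i₁ i₀≢i₁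
    where
    i₀ = proj₁ (F.enum-surj FR.0#)
    i₁ = proj₁ (F.enum-surj FR.1#)
    i₀≢i₁ : ¬ (i₀ ≡ i₁)
    i₀≢i₁ e = F.0≉1 (FR.trans (FR.sym (proj₂ (F.enum-surj FR.0#)))
                    (FR.trans (FR.reflexive (cong F.enum e)) (proj₂ (F.enum-surj FR.1#))))

  inv[q-1] : KR.Carrier
  inv[q-1] = proj₁ (K.inverse (ofℕ (F.q ∸ 1)) q-1≉0)

  -- summand of the Jacobi sum indexed by x (with y = 1 - x);
  -- only pairs with x, y ∈ 𝔽* contribute
  Jterm : (F* → KR.Carrier) → (F* → KR.Carrier) → FR.Carrier → KR.Carrier
  Jterm α β x with x F.≟ FR.0# | (FR.1# FR.+ (FR.- x)) F.≟ FR.0#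
  ... | yes _ | _     = KR.0#
  ... | no _  | yes _ = KR.0#
  ... | no p  | no r  = α (x , p) KR.* β (FR.1# FR.+ (FR.- x) , r)

  𝕁 : (F* → KR.Carrier) → (F* → KR.Carrier) → KR.Carrier
  𝕁 α β = inv[q-1] KR.* ∑ F.q (λ i → Jterm α β (F.enum i))

  record EnumeratesCharacters (m : ℕ) (ch : Fin m → Character) : Set (c ⊔ ℓ ⊔ c' ⊔ ℓ') where
    field
      complete : ∀ (ψ : Character) → ∃ λ i → ∀ x → χ ψ x KR.≈ χ (ch i) x
      distinct : ∀ i j → (∀ x → χ (ch i) x KR.≈ χ (ch j) x) → i ≡ j

{-# OPTIONS --safe #-}
module Submission where

-- Expanding both Jacobi sums, the left-hand side is (q-1)⁻² times the sum over x, y ∉ {0, 1} of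
-- α₁(x) α₂(1-x) α₃(y) α₄(1-y) ∑_β β(x (1-x)⁻¹ y (1-y)⁻¹). By orthogonality of characters the inner sum is |𝕄|
-- when x y = (1-x)(1-y), i.e. y = 1-x, and 0 otherwise; what is left is |𝕄| (q-1)⁻² ∑_x (α₁α₄)(x) (α₂α₃)(1-x),
-- and |𝕄| = q-1. Orthogonality needs enough characters: for w ≠ 1 a character with β(w) ≠ 1 is built on ⟨w⟩ and
-- extended to 𝔽* one generator at a time, taking roots in the algebraically closed field. Summing β(x) over
-- β ∈ 𝕄 and x ∈ 𝔽* in both orders then gives |𝕄| = q-1.

open import Defs
open import Level using (Level; _⊔_) renaming (suc to lsuc)
open import Algebra.Bundles using (CommutativeRing; AbelianGroup)
open import Algebra.Morphism.Structures using (module MonoidMorphisms)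
open import Data.Nat as Nat using (ℕ; zero; suc; pred; _∸_; z≤n; s≤s)
open import Data.Fin as Fin using (Fin; toℕ) renaming (zero to fzero; suc to fsuc)
open import Data.Fin.Properties using (punchInᵢ≢i; pigeonhole; sequence)
open import Data.Fin.Permutation using (Permutation; permutation; _⟨$⟩ʳ_)
open import Data.Product using (∃; _,_; proj₁; proj₂; _×_)
open import Effect.Monad using (RawMonad)
open import Function using (_∘_)
open import Relation.Nullary using (¬_; Dec; yes; no; contradiction; ¬?)
open import Relation.Nullary.Negation using (¬¬-Monad; ¬¬-map)
open import Relation.Nullary.Decidable using (decidable-stable; _×-dec_)
open import Relation.Unary using (Pred) renaming (Decidable to Decidable₁)
open import Relation.Binary using (Decidable; tri<; tri≈; tri>)
open import Relation.Binary.PropositionalEquality as ≡ using (_≡_; _≢_)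
import Relation.Binary.Reasoning.Setoid as SetoidReasoning
import Algebra.Solver.CommutativeMonoid as CommutativeMonoidSolver

module FiniteSums {c ℓ : Level} (R : CommutativeRing c ℓ) where
  open CommutativeRing R
  open RingOps R
  open import Algebra.Properties.Semiring.Sum semiring public

  ∑≡sum : ∀ n (f : Fin n → Carrier) → ∑ n f ≡ sum f
  ∑≡sum zero    f = ≡.refl
  ∑≡sum (suc n) f = ≡.cong (f fzero +_) (∑≡sum n (λ i → f (fsuc i)))

  sum-zero : ∀ {n} {f : Fin n → Carrier} → (∀ i → f i ≈ 0#) → sum f ≈ 0#
  sum-zero {n} f≈0 = trans (sum-cong-≋ f≈0) (sum-replicate-zero n)

  sum-ones : ∀ {n} {f : Fin n → Carrier} → (∀ i → f i ≈ 1#) → sum f ≈ ofℕ n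
  sum-ones {zero}  f≈1 = refl
  sum-ones {suc n} f≈1 = +-cong (f≈1 fzero) (sum-ones (λ i → f≈1 (fsuc i)))

  sum-single : ∀ {n} {f : Fin n → Carrier} (j : Fin n) → (∀ i → i ≢ j → f i ≈ 0#) → sum f ≈ f j
  sum-single {suc n} {f} j f≈0 = trans (sum-remove {i = j} f)
    (trans (+-congˡ (sum-zero (λ i → f≈0 _ (punchInᵢ≢i j i)))) (+-identityʳ _))

  sum-ones-but-one : ∀ {n} {f : Fin n → Carrier} (j : Fin n) → f j ≈ 0# → (∀ i → i ≢ j → f i ≈ 1#) →
                     sum f ≈ ofℕ (n ∸ 1)
  sum-ones-but-one {suc n} {f} j fj≈0 f≈1 = trans (sum-remove {i = j} f)
    (trans (+-cong fj≈0 (sum-ones (λ i → f≈1 _ (punchInᵢ≢i j i)))) (+-identityˡ _))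

  sum-*-sum : ∀ {m n} (f : Fin m → Carrier) (g : Fin n → Carrier) →
              sum f * sum g ≈ sum (λ i → sum (λ j → f i * g j))
  sum-*-sum {m} {n} f g = trans (*-distribʳ-sum (sum g) f) (sum-cong-≋ {m} (λ i → *-distribˡ-sum (f i) g))

module Complement {c ℓ : Level} (R : CommutativeRing c ℓ) where
  open CommutativeRing R
  open SetoidReasoning setoid

  infix 8 1-_
  1-_ : Carrier → Carrier
  1- a = 1# + - a

  a+[1-a]≈1 : ∀ a → a + 1- a ≈ 1#
  a+[1-a]≈1 a = begin
    a + (1# + - a)  ≈⟨ solve 3 (λ x o y → x ⊕ (o ⊕ y) ⊜ o ⊕ (x ⊕ y)) refl a 1# (- a) ⟩
    1# + (a - a)    ≈⟨ +-congˡ (-‿inverseʳ a) ⟩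
    1# + 0#         ≈⟨ +-identityʳ 1# ⟩
    1#              ∎
    where open CommutativeMonoidSolver +-commutativeMonoid using (solve; _⊕_; _⊜_)

  1-[1-a]≈a : ∀ a → 1- (1- a) ≈ a
  1-[1-a]≈a a = ∙-cancelˡ (1- a) _ _ (trans (a+[1-a]≈1 (1- a)) (sym (trans (+-comm (1- a) a) (a+[1-a]≈1 a))))
    where open import Algebra.Properties.Group +-group using (∙-cancelˡ)

  ab≈[1-a][1-b]⇒b≈1-a : ∀ {a b} → a * b ≈ 1- a * 1- b → b ≈ 1- a
  ab≈[1-a][1-b]⇒b≈1-a {a} {b} ab≈[1-a][1-b] = begin
    b                        ≈⟨ *-identityˡ b ⟨
    1# * b                   ≈⟨ *-congʳ (a+[1-a]≈1 a) ⟨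
    (a + 1- a) * b           ≈⟨ distribʳ b a (1- a) ⟩
    a * b + 1- a * b         ≈⟨ +-congʳ ab≈[1-a][1-b] ⟩
    1- a * 1- b + 1- a * b   ≈⟨ distribˡ (1- a) (1- b) b ⟨
    1- a * (1- b + b)        ≈⟨ *-congˡ (trans (+-comm (1- b) b) (a+[1-a]≈1 b)) ⟩
    1- a * 1#                ≈⟨ *-identityʳ (1- a) ⟩
    1- a                     ∎

least-witness : ∀ {p} {P : Pred ℕ p} → Decidable₁ P → ∀ {n} → P n →
                ∃ λ k → P k × (∀ {j} → j Nat.< k → ¬ P j)
least-witness P? {zero}  P0 = 0 , P0 , λ ()
least-witness P? {suc n} Pn with P? 0
... | yes P0 = 0 , P0 , λ ()
... | no ¬P0 with least-witness (P? ∘ suc) Pn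
...   | k , Pk , below = suc k , Pk , λ { {zero} _ → ¬P0 ; {suc j} (s≤s j<k) → below j<k }

module CharacterExtension {g gℓ k kℓ : Level} (G : AbelianGroup g gℓ) (R : CommutativeRing k kℓ) where
  open AbelianGroup G
  open Nat using (_+_; _<_)
  open import Data.Nat.Properties
    using ( ≤-refl; ≤-trans; ≤-<-trans; <-cmp; _<?_; ≮⇒≥; m≤n⇒∃[o]m+o≡n
          ; +-cancelˡ-<; +-mono-<; +-suc; +-comm; m≤n+m; anyUpTo?)
  open import Algebra.Properties.Group group using (ε⁻¹≈ε; ∙-cancelˡ)
  open import Algebra.Properties.AbelianGroup G using (⁻¹-∙-comm)
  open import Algebra.Properties.Monoid.Mult monoid using (×-homo-+) renaming (_×_ to _times_)
  open CommutativeMonoidSolver commutativeMonoid using (solve; _⊕_; _⊜_)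

  module R where
    open CommutativeRing R public
    open import Algebra.Properties.Semiring.Exp semiring public using (_^_; ^-homo-*)
    open CommutativeMonoidSolver *-commutativeMonoid public using (solve; _⊕_; _⊜_)

  infixr 8 _^_
  _^_ : Carrier → ℕ → Carrier
  x ^ n = n times x

  finite-torsion : ∀ {n} (code : Carrier → Fin n) → (∀ {x y} → code x ≡ code y → x ≈ y) →
                   ∀ x → ∃ λ k → x ^ suc k ≈ ε
  finite-torsion {n} code code-inj x with pigeonhole ≤-refl (λ i → code (x ^ toℕ i))
  ... | i , j , i<j , same with m≤n⇒∃[o]m+o≡n i<j
  ... | k , 1+i+k≡j = k , ∙-cancelˡ (x ^ toℕ i) _ _ (begin
    x ^ toℕ i ∙ x ^ suc k  ≈⟨ ×-homo-+ x (toℕ i) (suc k) ⟨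
    x ^ (toℕ i + suc k)    ≡⟨ ≡.cong (x ^_) (≡.trans (+-suc (toℕ i) k) 1+i+k≡j) ⟩
    x ^ toℕ j              ≈⟨ code-inj same ⟨
    x ^ toℕ i              ≈⟨ identityʳ _ ⟨
    x ^ toℕ i ∙ ε          ∎)
    where open SetoidReasoning setoid

  record PartialCharacter : Set (g ⊔ lsuc gℓ ⊔ k ⊔ kℓ) where
    field
      dom      : Pred Carrier gℓ
      dom?     : Decidable₁ dom
      dom-resp : ∀ {x y} → x ≈ y → dom x → dom y
      dom-ε    : dom ε
      dom-∙    : ∀ {x y} → dom x → dom y → dom (x ∙ y)
      φ        : Carrier → R.Carrier
      φ-cong   : ∀ {x y} → dom x → x ≈ y → φ x R.≈ φ y
      φ-ε      : φ ε R.≈ R.1#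
      φ-∙      : ∀ {x y} → dom x → dom y → φ (x ∙ y) R.≈ φ x R.* φ y
  open PartialCharacter

  _⊑_ : PartialCharacter → PartialCharacter → Set (g ⊔ gℓ ⊔ kℓ)
  P ⊑ Q = ∀ {x} → dom P x → dom Q x × φ Q x R.≈ φ P x

  ⊑-refl : ∀ {P} → P ⊑ P
  ⊑-refl x∈P = x∈P , R.refl

  ⊑-trans : ∀ {P Q S} → P ⊑ Q → Q ⊑ S → P ⊑ S
  ⊑-trans P⊑Q Q⊑S x∈P with P⊑Q x∈P
  ... | x∈Q , φQ≈φP with Q⊑S x∈Q
  ... | x∈S , φS≈φQ = x∈S , R.trans φS≈φQ φQ≈φP

  trivialPartialCharacter : Decidable _≈_ → PartialCharacter
  trivialPartialCharacter _≟_ = record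
    { dom = _≈ ε ; dom? = _≟ ε ; dom-resp = λ x≈y x≈ε → trans (sym x≈y) x≈ε ; dom-ε = refl
    ; dom-∙ = λ x≈ε y≈ε → trans (∙-cong x≈ε y≈ε) (identityˡ ε)
    ; φ = λ _ → R.1# ; φ-cong = λ _ _ → R.refl ; φ-ε = R.refl ; φ-∙ = λ _ _ → R.sym (R.*-identityˡ R.1#) }

  module Extension (torsion : ∀ x → ∃ λ n → x ^ suc n ≈ ε) where

    dom-^ : ∀ P {x} n → dom P x → dom P (x ^ n)
    dom-^ P zero    x∈P = dom-ε P
    dom-^ P (suc n) x∈P = dom-∙ P x∈P (dom-^ P n x∈P)

    -- Inverse-closure is not a field of PartialCharacter: in a torsion group x ^ n is an inverse of x.
    dom-cancelˡ : ∀ P {x y} → dom P x → dom P (x ∙ y) → dom P y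
    dom-cancelˡ P {x} {y} x∈P xy∈P = dom-resp P y≈ (dom-∙ P (dom-^ P n x∈P) xy∈P)
      where
      open SetoidReasoning setoid
      n = proj₁ (torsion x)
      y≈ : x ^ n ∙ (x ∙ y) ≈ y
      y≈ = begin
        x ^ n ∙ (x ∙ y)  ≈⟨ assoc (x ^ n) x y ⟨
        x ^ n ∙ x ∙ y    ≈⟨ ∙-congʳ (comm (x ^ n) x) ⟩
        x ^ suc n ∙ y    ≈⟨ ∙-congʳ (proj₂ (torsion x)) ⟩
        ε ∙ y            ≈⟨ identityˡ y ⟩
        y                ∎

    -- With e the least positive exponent such that g ^ e ∈ dom P, each element of the enlarged domain is
    -- h ∙ g ^ j for a unique h ∈ dom P and j < e, and φ′ (h ∙ g ^ j) = φ h * c ^ j extends φ once c ^ e ≈ φ (g ^ e).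
    module Adjoin (P : PartialCharacter) (g : Carrier) where
      private
        least = least-witness (λ j → dom? P (g ^ suc j)) {proj₁ (torsion g)}
                              (dom-resp P (sym (proj₂ (torsion g))) (dom-ε P))

      e : ℕ
      e = suc (proj₁ least)

      g^e∈P : dom P (g ^ e)
      g^e∈P = proj₁ (proj₂ least)

      g^j∉P : ∀ {j} → suc j < e → ¬ dom P (g ^ suc j)
      g^j∉P (s≤s j<e-1) = proj₂ (proj₂ least) j<e-1

      _/g^_ : Carrier → ℕ → Carrier
      x /g^ j = x ∙ (g ^ j) ⁻¹

      /g^-zero : ∀ x → x /g^ 0 ≈ x
      /g^-zero x = trans (∙-congˡ ε⁻¹≈ε) (identityʳ x)

      /g^-∙ : ∀ x y j j' → (x /g^ j) ∙ (y /g^ j') ≈ (x ∙ y) /g^ (j + j')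
      /g^-∙ x y j j' = begin
        (x ∙ (g ^ j) ⁻¹) ∙ (y ∙ (g ^ j') ⁻¹)
          ≈⟨ solve 4 (λ x a y b → (x ⊕ a) ⊕ (y ⊕ b) ⊜ (x ⊕ y) ⊕ (a ⊕ b)) refl _ _ _ _ ⟩
        (x ∙ y) ∙ ((g ^ j) ⁻¹ ∙ (g ^ j') ⁻¹)  ≈⟨ ∙-congˡ (⁻¹-∙-comm (g ^ j) (g ^ j')) ⟩
        (x ∙ y) ∙ (g ^ j ∙ g ^ j') ⁻¹         ≈⟨ ∙-congˡ (⁻¹-cong (×-homo-+ g j j')) ⟨
        (x ∙ y) /g^ (j + j')                  ∎
        where open SetoidReasoning setoid

      /g^-shift : ∀ x i j {k} → i + j ≡ k → (x /g^ k) ∙ g ^ i ≈ x /g^ j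
      /g^-shift x i j ≡.refl = begin
        (x /g^ (i + j)) ∙ g ^ i                       ≈⟨ ∙-congʳ (∙-congˡ (⁻¹-cong (×-homo-+ g i j))) ⟩
        (x ∙ (g ^ i ∙ g ^ j) ⁻¹) ∙ g ^ i              ≈⟨ ∙-congʳ (∙-congˡ (⁻¹-∙-comm (g ^ i) (g ^ j))) ⟨
        (x ∙ ((g ^ i) ⁻¹ ∙ (g ^ j) ⁻¹)) ∙ g ^ i
          ≈⟨ solve 4 (λ x a b c → (x ⊕ (a ⊕ b)) ⊕ c ⊜ (x ⊕ b) ⊕ (a ⊕ c)) refl _ _ _ _ ⟩
        (x /g^ j) ∙ ((g ^ i) ⁻¹ ∙ g ^ i)              ≈⟨ ∙-congˡ (inverseˡ (g ^ i)) ⟩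
        (x /g^ j) ∙ ε                                 ≈⟨ identityʳ _ ⟩
        x /g^ j                                       ∎
        where open SetoidReasoning setoid

      g/g^1≈ε : g /g^ 1 ≈ ε
      g/g^1≈ε = trans (∙-congˡ (⁻¹-cong (identityʳ g))) (inverseʳ g)

      dom′ : Pred Carrier gℓ
      dom′ x = ∃ λ j → j < e × dom P (x /g^ j)

      exponent-gap : ∀ {x i j} → i < j → j < e → dom P (x /g^ i) → ¬ dom P (x /g^ j)
      exponent-gap {x} {i} i<j j<e x/g^i∈P x/g^j∈P with m≤n⇒∃[o]m+o≡n i<j
      ... | t , ≡.refl = g^j∉P (≤-<-trans (s≤s (m≤n+m t i)) j<e)
        (dom-cancelˡ P x/g^j∈P (dom-resp P (sym (/g^-shift x (suc t) i (≡.cong suc (+-comm t i)))) x/g^i∈P))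

      exponent-unique : ∀ {x i j} → i < e → j < e → dom P (x /g^ i) → dom P (x /g^ j) → i ≡ j
      exponent-unique i<e j<e x/g^i∈P x/g^j∈P with <-cmp _ _
      ... | tri≈ _ i≡j _ = i≡j
      ... | tri< i<j _ _ = contradiction x/g^j∈P (exponent-gap i<j j<e x/g^i∈P)
      ... | tri> _ _ j<i = contradiction x/g^i∈P (exponent-gap j<i i<e x/g^j∈P)

      dom′-intro : ∀ {x j} → j < e + e → dom P (x /g^ j) → dom′ x
      dom′-intro {x} {j} j<2e x/g^j∈P with j <? e
      ... | yes j<e = j , j<e , x/g^j∈P
      ... | no j≮e with m≤n⇒∃[o]m+o≡n (≮⇒≥ j≮e)
      ... | s , e+s≡j = s , +-cancelˡ-< e s e (≡.subst (_< e + e) (≡.sym e+s≡j) j<2e)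
                      , dom-resp P (/g^-shift x e s e+s≡j) (dom-∙ P x/g^j∈P g^e∈P)

      dom′? : Decidable₁ dom′
      dom′? x = anyUpTo? (λ j → dom? P (x /g^ j)) e

      module _ (c : R.Carrier) (c^e≈φg^e : c R.^ e R.≈ φ P (g ^ e)) where
        φ′ : Carrier → R.Carrier
        φ′ x with dom′? x
        ... | yes (j , _ , _) = φ P (x /g^ j) R.* c R.^ j
        ... | no _            = R.1#  -- junk value off the enlarged domain

        φ′-spec : ∀ {x j} → j < e → dom P (x /g^ j) → φ′ x R.≈ φ P (x /g^ j) R.* c R.^ j
        φ′-spec {x} j<e x/g^j∈P with dom′? x
        ... | no x∉P′ = contradiction (_ , j<e , x/g^j∈P) x∉P′
        ... | yes (i , i<e , x/g^i∈P) with exponent-unique i<e j<e x/g^i∈P x/g^j∈P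
        ...   | ≡.refl = R.refl

        φ′-spec⁺ : ∀ {x j} → j < e + e → dom P (x /g^ j) → φ′ x R.≈ φ P (x /g^ j) R.* c R.^ j
        φ′-spec⁺ {x} {j} j<2e x/g^j∈P with j <? e
        ... | yes j<e = φ′-spec j<e x/g^j∈P
        ... | no j≮e with m≤n⇒∃[o]m+o≡n (≮⇒≥ j≮e)
        ... | s , ≡.refl = R.trans (φ′-spec s<e x/g^s∈P) (begin
          φ P (x /g^ s) R.* c R.^ s
            ≈⟨ R.*-congʳ (φ-cong P x/g^j·g^e∈P (/g^-shift x e s ≡.refl)) ⟨
          φ P ((x /g^ (e + s)) ∙ g ^ e) R.* c R.^ s
            ≈⟨ R.*-congʳ (φ-∙ P x/g^j∈P g^e∈P) ⟩
          φ P (x /g^ (e + s)) R.* φ P (g ^ e) R.* c R.^ s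
            ≈⟨ R.*-congʳ (R.*-congˡ c^e≈φg^e) ⟨
          φ P (x /g^ (e + s)) R.* c R.^ e R.* c R.^ s
            ≈⟨ R.*-assoc _ _ _ ⟩
          φ P (x /g^ (e + s)) R.* (c R.^ e R.* c R.^ s)
            ≈⟨ R.*-congˡ (R.^-homo-* c e s) ⟨
          φ P (x /g^ (e + s)) R.* c R.^ (e + s)            ∎)
          where
          open SetoidReasoning R.setoid
          s<e : s < e
          s<e = +-cancelˡ-< e s e j<2e
          x/g^j·g^e∈P = dom-∙ P x/g^j∈P g^e∈P
          x/g^s∈P = dom-resp P (/g^-shift x e s ≡.refl) x/g^j·g^e∈P

        private
          x∈P⇒x/g^0∈P : ∀ {x} → dom P x → dom P (x /g^ 0)
          x∈P⇒x/g^0∈P = dom-resp P (sym (/g^-zero _))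

          0<e : 0 < e
          0<e = s≤s z≤n

        φ′-∙ : ∀ {x y} → dom′ x → dom′ y → φ′ (x ∙ y) R.≈ φ′ x R.* φ′ y
        φ′-∙ {x} {y} (i , i<e , x/g^i∈P) (j , j<e , y/g^j∈P) = begin
          φ′ (x ∙ y)
            ≈⟨ φ′-spec⁺ (+-mono-< i<e j<e) xy/g^i+j∈P ⟩
          φ P ((x ∙ y) /g^ (i + j)) R.* c R.^ (i + j)
            ≈⟨ R.*-cong (φ-cong P prod∈P (/g^-∙ x y i j)) (R.sym (R.^-homo-* c i j)) ⟨
          φ P ((x /g^ i) ∙ (y /g^ j)) R.* (c R.^ i R.* c R.^ j)
            ≈⟨ R.*-congʳ (φ-∙ P x/g^i∈P y/g^j∈P) ⟩
          φ P (x /g^ i) R.* φ P (y /g^ j) R.* (c R.^ i R.* c R.^ j)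
            ≈⟨ R.solve 4 (λ a b u v → (a R.⊕ b) R.⊕ (u R.⊕ v) R.⊜ (a R.⊕ u) R.⊕ (b R.⊕ v)) R.refl _ _ _ _ ⟩
          φ P (x /g^ i) R.* c R.^ i R.* (φ P (y /g^ j) R.* c R.^ j)
            ≈⟨ R.*-cong (φ′-spec i<e x/g^i∈P) (φ′-spec j<e y/g^j∈P) ⟨
          φ′ x R.* φ′ y
            ∎
          where
          open SetoidReasoning R.setoid
          prod∈P = dom-∙ P x/g^i∈P y/g^j∈P
          xy/g^i+j∈P = dom-resp P (/g^-∙ x y i j) prod∈P

        adjoin : PartialCharacter
        adjoin = record
          { dom      = dom′
          ; dom?     = dom′?
          ; dom-resp = λ x≈y (j , j<e , x/g^j∈P) → j , j<e , dom-resp P (∙-congʳ x≈y) x/g^j∈P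
          ; dom-ε    = 0 , 0<e , x∈P⇒x/g^0∈P (dom-ε P)
          ; dom-∙    = λ (i , i<e , x/g^i∈P) (j , j<e , y/g^j∈P) →
                         dom′-intro (+-mono-< i<e j<e) (dom-resp P (/g^-∙ _ _ i j) (dom-∙ P x/g^i∈P y/g^j∈P))
          ; φ        = φ′
          ; φ-cong   = λ (j , j<e , x/g^j∈P) x≈y →
                         R.trans (φ′-spec j<e x/g^j∈P)
                           (R.trans (R.*-congʳ (φ-cong P x/g^j∈P (∙-congʳ x≈y)))
                             (R.sym (φ′-spec j<e (dom-resp P (∙-congʳ x≈y) x/g^j∈P))))
          ; φ-ε      = R.trans (φ′-spec 0<e ε/g^0∈P)
                         (R.trans (R.*-identityʳ _) (R.trans (φ-cong P ε/g^0∈P (/g^-zero ε)) (φ-ε P)))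
          ; φ-∙      = φ′-∙
          }
          where ε/g^0∈P = x∈P⇒x/g^0∈P (dom-ε P)

        P⊑adjoin : P ⊑ adjoin
        P⊑adjoin {x} x∈P = (0 , 0<e , x∈P⇒x/g^0∈P x∈P)
                         , R.trans (φ′-spec 0<e (x∈P⇒x/g^0∈P x∈P))
                             (R.trans (R.*-identityʳ _) (φ-cong P (x∈P⇒x/g^0∈P x∈P) (/g^-zero x)))

        private
          1<e+e : 1 < e + e
          1<e+e = s≤s (≤-trans 0<e (m≤n+m e _))

          g/g^1∈P : dom P (g /g^ 1)
          g/g^1∈P = dom-resp P (sym g/g^1≈ε) (dom-ε P)

        g∈adjoin : dom adjoin g
        g∈adjoin = dom′-intro 1<e+e g/g^1∈P

        φ′g≈c : φ adjoin g R.≈ c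
        φ′g≈c = R.trans (φ′-spec⁺ 1<e+e g/g^1∈P)
          (R.trans (R.*-cong (R.trans (φ-cong P g/g^1∈P g/g^1≈ε) (φ-ε P)) (R.*-identityʳ c)) (R.*-identityˡ c))

    module _ (root : ∀ n a → ∃ λ c → c R.^ suc n R.≈ a) where
      rootFor : ∀ P g → ∃ λ c → c R.^ Adjoin.e P g R.≈ φ P (g ^ Adjoin.e P g)
      rootFor P g = root (pred e) (φ P (g ^ e)) where open Adjoin P g

      adjoinRoot : PartialCharacter → Carrier → PartialCharacter
      adjoinRoot P g = Adjoin.adjoin P g (proj₁ (rootFor P g)) (proj₂ (rootFor P g))

      P⊑adjoinRoot : ∀ P g → P ⊑ adjoinRoot P g
      P⊑adjoinRoot P g = Adjoin.P⊑adjoin P g (proj₁ (rootFor P g)) (proj₂ (rootFor P g))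

      g∈adjoinRoot : ∀ P g → dom (adjoinRoot P g) g
      g∈adjoinRoot P g = Adjoin.g∈adjoin P g (proj₁ (rootFor P g)) (proj₂ (rootFor P g))

      adjoinAll : ∀ {n} → (Fin n → Carrier) → PartialCharacter → PartialCharacter
      adjoinAll {zero}  xs P = P
      adjoinAll {suc n} xs P = adjoinAll (xs ∘ fsuc) (adjoinRoot P (xs fzero))

      P⊑adjoinAll : ∀ {n} xs P → P ⊑ adjoinAll {n} xs P
      P⊑adjoinAll {zero}  xs P = ⊑-refl {P}
      P⊑adjoinAll {suc n} xs P =
        ⊑-trans {P} {Q} {adjoinAll (xs ∘ fsuc) Q} (P⊑adjoinRoot P (xs fzero)) (P⊑adjoinAll (xs ∘ fsuc) Q)
        where Q = adjoinRoot P (xs fzero)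

      xs∈adjoinAll : ∀ {n} xs P (i : Fin n) → dom (adjoinAll xs P) (xs i)
      xs∈adjoinAll xs P fzero    = proj₁ (P⊑adjoinAll (xs ∘ fsuc) _ (g∈adjoinRoot P (xs fzero)))
      xs∈adjoinAll xs P (fsuc i) = xs∈adjoinAll (xs ∘ fsuc) _ i

  module _ (_≟_ : Decidable _≈_) {N} (enum : Fin N → Carrier) (enum-surj : ∀ x → ∃ λ i → enum i ≈ x)
           (root : ∀ n a → ∃ λ c → c R.^ suc n R.≈ a)
           (root-of-unity : ∀ n → ∃ λ c → c R.^ suc (suc n) R.≈ R.1# × ¬ c R.≈ R.1#) where
    open MonoidMorphisms rawMonoid R.*-rawMonoid using (IsMonoidHomomorphism)

    private
      code : Carrier → Fin N
      code x = proj₁ (enum-surj x)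

      code-injective : ∀ {x y} → code x ≡ code y → x ≈ y
      code-injective {x} {y} same =
        trans (sym (proj₂ (enum-surj x))) (trans (reflexive (≡.cong enum same)) (proj₂ (enum-surj y)))

    open Extension (finite-torsion code code-injective)

    private module Trivial = Adjoin (trivialPartialCharacter _≟_)

    -- w ∉ {ε}, so e ≥ 2 and w can be sent to an e-th root of unity other than 1.
    adjoin-root-of-unity : ∀ w → ¬ w ≈ ε → ∃ λ P → dom P w × ¬ φ P w R.≈ R.1#
    adjoin-root-of-unity w w≉ε with Trivial.e w in e≡
    ... | suc zero    = contradiction (≡.subst (λ k → w ^ k ≈ ε) e≡ (Trivial.g^e∈P w))
                                      (w≉ε ∘ trans (sym (identityʳ w)))
    ... | suc (suc n) = Trivial.adjoin w c c^e≈1 , Trivial.g∈adjoin w c c^e≈1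
                      , λ φw≈1 → c≉1 (R.trans (R.sym (Trivial.φ′g≈c w c c^e≈1)) φw≈1)
      where
      c = proj₁ (root-of-unity n)
      c≉1 = proj₂ (proj₂ (root-of-unity n))
      c^e≈1 : c R.^ Trivial.e w R.≈ R.1#
      c^e≈1 = ≡.subst (λ k → c R.^ k R.≈ R.1#) (≡.sym e≡) (proj₁ (proj₂ (root-of-unity n)))

    separating-homomorphism : ∀ w → ¬ w ≈ ε → ∃ λ χ → IsMonoidHomomorphism χ × ¬ χ w R.≈ R.1#
    separating-homomorphism w w≉ε = φ Q , isHom , λ χw≈1 → φPw≉1 (R.trans (R.sym (proj₂ (P⊑Q w∈P))) χw≈1)
      where
      P = proj₁ (adjoin-root-of-unity w w≉ε)
      w∈P = proj₁ (proj₂ (adjoin-root-of-unity w w≉ε))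
      φPw≉1 = proj₂ (proj₂ (adjoin-root-of-unity w w≉ε))
      Q = adjoinAll root enum P
      P⊑Q = P⊑adjoinAll root enum P
      total : ∀ x → dom Q x
      total x = dom-resp Q (proj₂ (enum-surj x)) (xs∈adjoinAll root enum P (proj₁ (enum-surj x)))
      isHom : IsMonoidHomomorphism (φ Q)
      isHom = record
        { isMagmaHomomorphism = record
          { isRelHomomorphism = record { cong = φ-cong Q (total _) }
          ; homo = λ x y → φ-∙ Q (total x) (total y) }
        ; ε-homo = φ-ε Q }

module ACF₀Properties {c ℓ : Level} (𝕂 : ACF₀ c ℓ) where
  open ACF₀ 𝕂
  open CommutativeRing cring
  open RingOps cring using (ofℕ; pow; ∑)
  open FiniteSums cring
  open import Algebra.Properties.Semiring.Exp semiring using (_^_; ^-congˡ)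
  open import Algebra.Properties.Group +-group using (∙-cancelˡ; x∙y⁻¹≈ε⇒x≈y)
  open import Algebra.Properties.Ring ring using (x[y-z]≈xy-xz)
  open import Algebra.Solver.Ring.NaturalCoefficients.Default commutativeSemiring
    using (solve; _:+_; _:*_; _:=_)
  open SetoidReasoning setoid

  pow≡^ : ∀ x n → pow x n ≡ x ^ n
  pow≡^ x zero    = ≡.refl
  pow≡^ x (suc n) = ≡.cong (x *_) (pow≡^ x n)

  ofℕ-injective : ∀ {a b} → ofℕ a ≈ ofℕ b → a ≡ b
  ofℕ-injective {zero}  {zero}  _ = ≡.refl
  ofℕ-injective {zero}  {suc b} e = contradiction (sym e) (char0 b)
  ofℕ-injective {suc a} {zero}  e = contradiction e (char0 a)
  ofℕ-injective {suc a} {suc b} e = ≡.cong suc (ofℕ-injective (∙-cancelˡ 1# _ _ e))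

  root : ∀ n a → ∃ λ x → x ^ suc n ≈ a
  root n a = x , x∙y⁻¹≈ε⇒x≈y _ a (begin
    x ^ suc n - a                                                  ≡⟨ ≡.cong (_- a) (pow≡^ x (suc n)) ⟨
    pow x (suc n) - a                                              ≈⟨ +-congˡ lower-terms≈-a ⟨
    pow x (suc n) + ∑ (suc n) (λ i → coefficient i * pow x (toℕ i)) ≈⟨ proj₂ (algClosed n coefficient) ⟩
    0#                                                             ∎)
    where
    coefficient : Fin (suc n) → Carrier
    coefficient fzero    = - a
    coefficient (fsuc _) = 0#
    x = proj₁ (algClosed n coefficient)
    lower-terms≈-a : ∑ (suc n) (λ i → coefficient i * pow x (toℕ i)) ≈ - a
    lower-terms≈-a = trans (+-cong (*-identityʳ (- a))
                              (trans (reflexive (∑≡sum n _)) (sum-zero {n} (λ i → zeroˡ (pow x (toℕ (fsuc i)))))))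
                           (+-identityʳ (- a))

  geometric : ℕ → Carrier → Carrier
  geometric n x = sum (λ (i : Fin n) → x ^ toℕ i)

  geometric-suc : ∀ n x → geometric (suc n) x ≈ 1# + x * geometric n x
  geometric-suc n x = +-congˡ (sym (*-distribˡ-sum {n} x (λ i → x ^ toℕ i)))

  geometric-telescope : ∀ n x → x ^ n + geometric n x ≈ 1# + x * geometric n x
  geometric-telescope zero    x = +-congˡ (sym (zeroʳ x))
  geometric-telescope (suc n) x = begin
    x * x ^ n + geometric (suc n) x
      ≈⟨ +-congˡ (geometric-suc n x) ⟩
    x * x ^ n + (1# + x * geometric n x)
      ≈⟨ solve 4 (λ x p g o → x :* p :+ (o :+ x :* g) := o :+ x :* (p :+ g)) refl _ _ _ 1# ⟩
    1# + x * (x ^ n + geometric n x)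
      ≈⟨ +-congˡ (*-congˡ (geometric-telescope n x)) ⟩
    1# + x * (1# + x * geometric n x)
      ≈⟨ +-congˡ (*-congˡ (geometric-suc n x)) ⟨
    1# + x * geometric (suc n) x ∎

  root-of-unity : ∀ n → ∃ λ x → x ^ suc (suc n) ≈ 1# × ¬ x ≈ 1#
  root-of-unity n = x , x^n+2≈1 , x≉1
    where
    x = proj₁ (algClosed n (λ _ → 1#))

    geometric≈0 : geometric (suc (suc n)) x ≈ 0#
    geometric≈0 = begin
      geometric (suc (suc n)) x
        ≈⟨ geometric-suc (suc n) x ⟩
      1# + x * geometric (suc n) x
        ≈⟨ geometric-telescope (suc n) x ⟨
      x ^ suc n + geometric (suc n) x
        ≈⟨ +-cong (reflexive (pow≡^ x (suc n))) polynomial≈ ⟨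
      pow x (suc n) + ∑ (suc n) (λ i → 1# * pow x (toℕ i))
        ≈⟨ proj₂ (algClosed n (λ _ → 1#)) ⟩
      0# ∎
      where
      polynomial≈ : ∑ (suc n) (λ i → 1# * pow x (toℕ i)) ≈ geometric (suc n) x
      polynomial≈ = trans (reflexive (∑≡sum (suc n) (λ i → 1# * pow x (toℕ i))))
                          (sum-cong-≋ {suc n} (λ i → trans (*-identityˡ _) (reflexive (pow≡^ x (toℕ i)))))

    x^n+2≈1 : x ^ suc (suc n) ≈ 1#
    x^n+2≈1 = begin
      x ^ suc (suc n)                                   ≈⟨ +-identityʳ _ ⟨
      x ^ suc (suc n) + 0#                              ≈⟨ +-congˡ geometric≈0 ⟨
      x ^ suc (suc n) + geometric (suc (suc n)) x       ≈⟨ geometric-telescope (suc (suc n)) x ⟩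
      1# + x * geometric (suc (suc n)) x                ≈⟨ +-congˡ (trans (*-congˡ geometric≈0) (zeroʳ x)) ⟩
      1# + 0#                                           ≈⟨ +-identityʳ 1# ⟩
      1#                                                ∎

    1^i≈1 : ∀ i → 1# ^ i ≈ 1#
    1^i≈1 zero    = refl
    1^i≈1 (suc i) = trans (*-identityˡ _) (1^i≈1 i)

    x≉1 : ¬ x ≈ 1#
    x≉1 x≈1 = char0 (suc n) (begin
      ofℕ (suc (suc n))
        ≈⟨ sum-ones {suc (suc n)} (λ i → trans (^-congˡ (toℕ i) x≈1) (1^i≈1 (toℕ i))) ⟨
      geometric (suc (suc n)) x
        ≈⟨ geometric≈0 ⟩
      0#                         ∎)

  x*y≈x⇒x≈0 : ∀ {x y} → x * y ≈ x → ¬ y ≈ 1# → x ≈ 0#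
  x*y≈x⇒x≈0 {x} {y} xy≈x y≉1 = begin
    x                       ≈⟨ *-identityʳ x ⟨
    x * 1#                  ≈⟨ *-congˡ (proj₂ y-1-invertible) ⟨
    x * ((y - 1#) * z)      ≈⟨ *-assoc x (y - 1#) z ⟨
    x * (y - 1#) * z        ≈⟨ *-congʳ x[y-1]≈0 ⟩
    0# * z                  ≈⟨ zeroˡ z ⟩
    0#                      ∎
    where
    y-1-invertible = inverse (y - 1#) (λ y-1≈0 → y≉1 (x∙y⁻¹≈ε⇒x≈y y 1# y-1≈0))
    z = proj₁ y-1-invertible
    x[y-1]≈0 : x * (y - 1#) ≈ 0#
    x[y-1]≈0 = begin
      x * (y - 1#)       ≈⟨ x[y-z]≈xy-xz x y 1# ⟩
      x * y - x * 1#     ≈⟨ +-cong xy≈x (-‿cong (*-identityʳ x)) ⟩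
      x - x              ≈⟨ -‿inverseʳ x ⟩
      0#                 ∎

module CharacterGroup {c ℓ c' ℓ' : Level} (𝔽 : FiniteField c ℓ) (𝕂 : ACF₀ c' ℓ') where
  open Characters 𝔽 𝕂
  open ACF₀Properties 𝕂 using (root; root-of-unity; x*y≈x⇒x≈0)
  open RingOps K.cring using (ofℕ)
  open FiniteSums K.cring

  infix 4 _≈*_
  _≈*_ : F* → F* → Set ℓ
  x ≈* y = proj₁ x FR.≈ proj₁ y

  ·*-inverseʳ : ∀ x → x ·* (x ⁻¹*) ≈* 1*
  ·*-inverseʳ (x , x≉0) = proj₂ (F.inverse x x≉0)

  ⁻¹*-cong : ∀ {x y} → x ≈* y → x ⁻¹* ≈* y ⁻¹*
  ⁻¹*-cong {x} {y} x≈y = begin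
    x′                     ≈⟨ FR.*-identityʳ x′ ⟨
    x′ FR.* FR.1#          ≈⟨ FR.*-congˡ (·*-inverseʳ y) ⟨
    x′ FR.* (proj₁ y FR.* y′)  ≈⟨ solve 3 (λ a b d → a ⊕ (b ⊕ d) ⊜ (b ⊕ a) ⊕ d) FR.refl x′ (proj₁ y) y′ ⟩
    (proj₁ y FR.* x′) FR.* y′  ≈⟨ FR.*-congʳ (FR.*-congʳ x≈y) ⟨
    (proj₁ x FR.* x′) FR.* y′  ≈⟨ FR.*-congʳ (·*-inverseʳ x) ⟩
    FR.1# FR.* y′          ≈⟨ FR.*-identityˡ y′ ⟩
    y′                     ∎
    where
    open SetoidReasoning FR.setoid
    open CommutativeMonoidSolver FR.*-commutativeMonoid using (solve; _⊕_; _⊜_)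
    x′ = proj₁ (x ⁻¹*)
    y′ = proj₁ (y ⁻¹*)

  F*-abelianGroup : AbelianGroup (c ⊔ ℓ) ℓ
  F*-abelianGroup = record
    { _≈_ = _≈*_ ; _∙_ = _·*_ ; ε = 1* ; _⁻¹ = _⁻¹*
    ; isAbelianGroup = record
      { isGroup = record
        { isMonoid = record
          { isSemigroup = record
            { isMagma = record
              { isEquivalence = record { refl = FR.refl ; sym = FR.sym ; trans = FR.trans }
              ; ∙-cong = FR.*-cong }
            ; assoc = λ x y z → FR.*-assoc (proj₁ x) (proj₁ y) (proj₁ z) }
          ; identity = (λ x → FR.*-identityˡ (proj₁ x)) , (λ x → FR.*-identityʳ (proj₁ x)) }
        ; inverse = (λ x → FR.trans (FR.*-comm _ (proj₁ x)) (·*-inverseʳ x)) , ·*-inverseʳ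
        ; ⁻¹-cong = ⁻¹*-cong }
      ; comm = λ x y → FR.*-comm (proj₁ x) (proj₁ y) } }

  private
    nonzero-or-1 : ∀ a → Dec (a FR.≈ FR.0#) → F*
    nonzero-or-1 a (yes _)   = 1*
    nonzero-or-1 a (no a≉0) = a , a≉0

  enum* : Fin F.q → F*
  enum* j = nonzero-or-1 (F.enum j) (F.enum j F.≟ FR.0#)

  enum*-surjective : ∀ x → ∃ λ j → enum* j ≈* x
  enum*-surjective (a , a≉0) = j , hit (F.enum j F.≟ FR.0#)
    where
    j = proj₁ (F.enum-surj a)
    enum-j≈a = proj₂ (F.enum-surj a)
    hit : (d : Dec (F.enum j FR.≈ FR.0#)) → nonzero-or-1 (F.enum j) d ≈* (a , a≉0)
    hit (yes enum-j≈0) = contradiction (FR.trans (FR.sym enum-j≈a) enum-j≈0) a≉0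
    hit (no _)         = enum-j≈a

  separating-character : ∀ w → ¬ w ≈* 1* → ∃ λ ψ → ¬ χ ψ w KR.≈ KR.1#
  separating-character w w≉1 = ψ , proj₂ (proj₂ separation)
    where
    separation = CharacterExtension.separating-homomorphism F*-abelianGroup K.cring
                   (λ x y → proj₁ x F.≟ proj₁ y) enum* enum*-surjective root root-of-unity w w≉1
    open MonoidMorphisms.IsMonoidHomomorphism (proj₁ (proj₂ separation))
    ψ : Character
    ψ = record { χ = proj₁ separation ; χ-cong = λ _ _ → ⟦⟧-cong ; χ-one = ε-homo ; χ-mul = homo }

  Respects* : (F* → KR.Carrier) → Set (c ⊔ ℓ ⊔ ℓ')
  Respects* f = ∀ {x y} → x ≈* y → f x KR.≈ f y

  χ-resp : ∀ ψ → Respects* (χ ψ)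
  χ-resp ψ {x} {y} = χ-cong ψ x y

  infixl 7 _·ᶜ_
  _·ᶜ_ : Character → Character → Character
  ψ ·ᶜ φ = record
    { χ      = χ ψ ⊗ χ φ
    ; χ-cong = λ x y x≈y → KR.*-cong (χ-cong ψ x y x≈y) (χ-cong φ x y x≈y)
    ; χ-one  = KR.trans (KR.*-cong (χ-one ψ) (χ-one φ)) (KR.*-identityˡ KR.1#)
    ; χ-mul  = λ x y → KR.trans (KR.*-cong (χ-mul ψ x y) (χ-mul φ x y))
                 (solve 4 (λ a b a′ b′ → (a ⊕ b) ⊕ (a′ ⊕ b′) ⊜ (a ⊕ a′) ⊕ (b ⊕ b′)) KR.refl _ _ _ _)
    }
    where open CommutativeMonoidSolver KR.*-commutativeMonoid using (solve; _⊕_; _⊜_)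

  infix 8 _⁻¹ᶜ
  _⁻¹ᶜ : Character → Character
  ψ ⁻¹ᶜ = record
    { χ      = inv (χ ψ)
    ; χ-cong = λ x y x≈y → χ-cong ψ _ _ (⁻¹*-cong {x} {y} x≈y)
    ; χ-one  = KR.trans (χ-cong ψ _ _ ε⁻¹≈ε) (χ-one ψ)
    ; χ-mul  = λ x y → KR.trans (χ-cong ψ _ _ (FR.sym (⁻¹-∙-comm x y))) (χ-mul ψ _ _)
    }
    where
    open import Algebra.Properties.Group (AbelianGroup.group F*-abelianGroup) using (ε⁻¹≈ε)
    open import Algebra.Properties.AbelianGroup F*-abelianGroup using (⁻¹-∙-comm)

  𝟙 : Character
  𝟙 = record
    { χ = λ _ → KR.1# ; χ-cong = λ _ _ _ → KR.refl ; χ-one = KR.refl ; χ-mul = λ _ _ → KR.sym (KR.*-identityˡ KR.1#) }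

  χ-inverseʳ : ∀ ψ x → χ ψ x KR.* χ ψ (x ⁻¹*) KR.≈ KR.1#
  χ-inverseʳ ψ x = KR.trans (KR.sym (χ-mul ψ x (x ⁻¹*))) (KR.trans (χ-cong ψ _ _ (·*-inverseʳ x)) (χ-one ψ))

  χ-quotient : ∀ ψ x y u v → χ ψ ((x ·* y) ·* ((u ·* v) ⁻¹*)) KR.≈
                              (χ ψ x KR.* χ ψ y) KR.* (χ ψ (u ⁻¹*) KR.* χ ψ (v ⁻¹*))
  χ-quotient ψ x y u v = KR.trans (χ-mul ψ _ _) (KR.*-cong (χ-mul ψ x y)
    (KR.trans (χ-resp ψ {(u ·* v) ⁻¹*} {(u ⁻¹*) ·* (v ⁻¹*)} (FR.sym (⁻¹-∙-comm u v))) (χ-mul ψ _ _)))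
    where open import Algebra.Properties.AbelianGroup F*-abelianGroup using (⁻¹-∙-comm)

  code : FR.Carrier → Fin F.q
  code a = proj₁ (F.enum-surj a)

  enum-code : ∀ a → F.enum (code a) FR.≈ a
  enum-code a = proj₂ (F.enum-surj a)

  private
    scale-cancel : ∀ u v → v ·* u ≈* 1* → ∀ j → code (F.enum (code (F.enum j FR.* proj₁ v)) FR.* proj₁ u) ≡ j
    scale-cancel u v vu≈1 j = F.enum-inj _ _ (begin
      F.enum (code (F.enum (code (F.enum j FR.* proj₁ v)) FR.* proj₁ u))  ≈⟨ enum-code _ ⟩
      F.enum (code (F.enum j FR.* proj₁ v)) FR.* proj₁ u                   ≈⟨ FR.*-congʳ (enum-code _) ⟩
      F.enum j FR.* proj₁ v FR.* proj₁ u                                   ≈⟨ FR.*-assoc _ _ _ ⟩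
      F.enum j FR.* (proj₁ v FR.* proj₁ u)                                 ≈⟨ FR.*-congˡ vu≈1 ⟩
      F.enum j FR.* FR.1#                                                  ≈⟨ FR.*-identityʳ _ ⟩
      F.enum j                                                             ∎)
      where open SetoidReasoning FR.setoid

  scaling : F* → Permutation F.q F.q
  scaling z = permutation (λ j → code (F.enum j FR.* proj₁ z)) (λ j → code (F.enum j FR.* proj₁ (z ⁻¹*)))
                          (scale-cancel z (z ⁻¹*) (FR.trans (FR.*-comm _ _) (·*-inverseʳ z)))
                          (scale-cancel (z ⁻¹*) z (·*-inverseʳ z))

  private
    extendAt : (F* → KR.Carrier) → ∀ a → Dec (a FR.≈ FR.0#) → KR.Carrier
    extendAt f a (yes _)   = KR.0#
    extendAt f a (no a≉0) = f (a , a≉0)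

  extend : (F* → KR.Carrier) → FR.Carrier → KR.Carrier
  extend f a = extendAt f a (a F.≟ FR.0#)

  extend-zero : ∀ f {a} → a FR.≈ FR.0# → extend f a KR.≈ KR.0#
  extend-zero f {a} a≈0 = at (a F.≟ FR.0#)
    where
    at : ∀ d → extendAt f a d KR.≈ KR.0#
    at (yes _)   = KR.refl
    at (no a≉0) = contradiction a≈0 a≉0

  extend-nonzero : ∀ {f} → Respects* f → ∀ {a} (a≉0 : ¬ a FR.≈ FR.0#) → extend f a KR.≈ f (a , a≉0)
  extend-nonzero {f} f-resp {a} a≉0 = at (a F.≟ FR.0#)
    where
    at : ∀ d → extendAt f a d KR.≈ f (a , a≉0)
    at (yes a≈0) = contradiction a≈0 a≉0
    at (no _)    = f-resp FR.refl

  extend-cong : ∀ {f} → Respects* f → ∀ {a b} → a FR.≈ b → extend f a KR.≈ extend f b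
  extend-cong {f} f-resp {a} {b} a≈b = at (a F.≟ FR.0#)
    where
    at : ∀ d → extendAt f a d KR.≈ extend f b
    at (yes a≈0) = KR.sym (extend-zero f (FR.trans (FR.sym a≈b) a≈0))
    at (no a≉0)  = KR.trans (f-resp a≈b) (KR.sym (extend-nonzero f-resp (a≉0 ∘ FR.trans a≈b)))

  extend-mul : ∀ ψ a z → extend (χ ψ) (a FR.* proj₁ z) KR.≈ extend (χ ψ) a KR.* χ ψ z
  extend-mul ψ a z = at (a F.≟ FR.0#)
    where
    at : ∀ d → extend (χ ψ) (a FR.* proj₁ z) KR.≈ extendAt (χ ψ) a d KR.* χ ψ z
    at (yes a≈0) = KR.trans (extend-zero (χ ψ) (FR.trans (FR.*-congʳ a≈0) (FR.zeroˡ _))) (KR.sym (KR.zeroˡ _))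
    at (no a≉0)  = KR.trans (extend-nonzero (χ-resp ψ) (proj₂ ((a , a≉0) ·* z))) (χ-mul ψ (a , a≉0) z)

  extend-sum : ∀ {n} (f : Fin n → F* → KR.Carrier) a →
               extend (λ x → sum (λ i → f i x)) a KR.≈ sum (λ i → extend (f i) a)
  extend-sum {n} f a = at (a F.≟ FR.0#)
    where
    at : ∀ d → extendAt (λ x → sum (λ i → f i x)) a d KR.≈ sum (λ i → extendAt (f i) a d)
    at (yes _) = KR.sym (sum-zero {n} (λ _ → KR.refl))
    at (no _)  = KR.refl

  fieldSum : Character → KR.Carrier
  fieldSum ψ = sum (λ j → extend (χ ψ) (F.enum j))

  fieldSum-invariant : ∀ ψ z → fieldSum ψ KR.* χ ψ z KR.≈ fieldSum ψ
  fieldSum-invariant ψ z = begin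
    fieldSum ψ KR.* χ ψ z
      ≈⟨ *-distribʳ-sum (χ ψ z) (λ j → extend (χ ψ) (F.enum j)) ⟩
    sum (λ j → extend (χ ψ) (F.enum j) KR.* χ ψ z)
      ≈⟨ sum-cong-≋ {F.q} (λ j → extend-mul ψ (F.enum j) z) ⟨
    sum (λ j → extend (χ ψ) (F.enum j FR.* proj₁ z))
      ≈⟨ sum-cong-≋ {F.q} (λ j → extend-cong (χ-resp ψ) (enum-code _)) ⟨
    sum (λ j → extend (χ ψ) (F.enum (scaling z ⟨$⟩ʳ j)))
      ≈⟨ sum-permute (λ j → extend (χ ψ) (F.enum j)) (scaling z) ⟨
    fieldSum ψ ∎
    where open SetoidReasoning KR.setoid

  fieldSum-nontrivial : ∀ ψ z → ¬ χ ψ z KR.≈ KR.1# → fieldSum ψ KR.≈ KR.0#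
  fieldSum-nontrivial ψ z = x*y≈x⇒x≈0 (fieldSum-invariant ψ z)

  fieldSum-trivial : ∀ ψ → (∀ x → χ ψ x KR.≈ KR.1#) → fieldSum ψ KR.≈ ofℕ (F.q ∸ 1)
  fieldSum-trivial ψ trivial = sum-ones-but-one (code FR.0#) (extend-zero (χ ψ) (enum-code FR.0#))
    λ j j≢code0 → KR.trans (extend-nonzero (χ-resp ψ) (λ enum-j≈0 →
                     j≢code0 (F.enum-inj _ _ (FR.trans enum-j≈0 (FR.sym (enum-code FR.0#))))))
                   (trivial _)

module Orthogonality {c ℓ c' ℓ' : Level} (𝔽 : FiniteField c ℓ) (𝕂 : ACF₀ c' ℓ') (m : ℕ)
  (𝕄 : Fin m → Characters.Character 𝔽 𝕂) (𝕄-enumerates : Characters.EnumeratesCharacters 𝔽 𝕂 m 𝕄) where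
  open Characters 𝔽 𝕂
  open CharacterGroup 𝔽 𝕂
  open EnumeratesCharacters 𝕄-enumerates
  open RingOps K.cring using (ofℕ)
  open FiniteSums K.cring
  open ACF₀Properties 𝕂 using (x*y≈x⇒x≈0; ofℕ-injective)
  open RawMonad (¬¬-Monad {ℓ'}) using () renaming (rawApplicative to ¬¬-applicative)
  open SetoidReasoning KR.setoid
  open CommutativeMonoidSolver KR.*-commutativeMonoid using (solve; _⊕_; _⊜_)

  index : Character → Fin m
  index ψ = proj₁ (complete ψ)

  index-spec : ∀ ψ x → χ ψ x KR.≈ χ (𝕄 (index ψ)) x
  index-spec ψ = proj₂ (complete ψ)

  index-unique : ∀ {ψ i} → (∀ x → χ ψ x KR.≈ χ (𝕄 i) x) → index ψ ≡ i
  index-unique {ψ} ψ≈𝕄i = distinct _ _ (λ x → KR.trans (KR.sym (index-spec ψ x)) (ψ≈𝕄i x))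

  translation : Fin m → Permutation m m
  translation j = permutation (λ i → index (𝕄 i ·ᶜ 𝕄 j)) (λ i → index (𝕄 i ·ᶜ 𝕄 j ⁻¹ᶜ))
    (λ i → index-unique λ x → begin
      χ (𝕄 (index (𝕄 i ·ᶜ 𝕄 j ⁻¹ᶜ))) x KR.* φ x
        ≈⟨ KR.*-congʳ (index-spec (𝕄 i ·ᶜ 𝕄 j ⁻¹ᶜ) x) ⟨
      χ (𝕄 i) x KR.* φ (x ⁻¹*) KR.* φ x
        ≈⟨ solve 3 (λ a b c → (a ⊕ b) ⊕ c ⊜ a ⊕ (c ⊕ b)) KR.refl _ _ _ ⟩
      χ (𝕄 i) x KR.* (φ x KR.* φ (x ⁻¹*))
        ≈⟨ KR.*-congˡ (χ-inverseʳ (𝕄 j) x) ⟩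
      χ (𝕄 i) x KR.* KR.1#
        ≈⟨ KR.*-identityʳ _ ⟩
      χ (𝕄 i) x                                         ∎)
    (λ i → index-unique λ x → begin
      χ (𝕄 (index (𝕄 i ·ᶜ 𝕄 j))) x KR.* φ (x ⁻¹*)       ≈⟨ KR.*-congʳ (index-spec (𝕄 i ·ᶜ 𝕄 j) x) ⟨
      χ (𝕄 i) x KR.* φ x KR.* φ (x ⁻¹*)                 ≈⟨ KR.*-assoc _ _ _ ⟩
      χ (𝕄 i) x KR.* (φ x KR.* φ (x ⁻¹*))               ≈⟨ KR.*-congˡ (χ-inverseʳ (𝕄 j) x) ⟩
      χ (𝕄 i) x KR.* KR.1#                              ≈⟨ KR.*-identityʳ _ ⟩
      χ (𝕄 i) x                                         ∎)
    where φ = χ (𝕄 j)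

  characterSum : F* → KR.Carrier
  characterSum w = sum (λ i → χ (𝕄 i) w)

  characterSum-invariant : ∀ j w → characterSum w KR.* χ (𝕄 j) w KR.≈ characterSum w
  characterSum-invariant j w = begin
    characterSum w KR.* χ (𝕄 j) w                         ≈⟨ *-distribʳ-sum (χ (𝕄 j) w) (λ i → χ (𝕄 i) w) ⟩
    sum (λ i → χ (𝕄 i) w KR.* χ (𝕄 j) w)                  ≈⟨ sum-cong-≋ (λ i → index-spec (𝕄 i ·ᶜ 𝕄 j) w) ⟩
    sum (λ i → χ (𝕄 (translation j ⟨$⟩ʳ i)) w)             ≈⟨ sum-permute (λ i → χ (𝕄 i) w) (translation j) ⟨
    characterSum w                                        ∎

  characterSum-≉1 : ∀ w → ¬ w ≈* 1* → characterSum w KR.≈ KR.0#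
  characterSum-≉1 w w≉1 = x*y≈x⇒x≈0 (characterSum-invariant (index ψ) w) (ψw≉1 ∘ KR.trans (index-spec ψ w))
    where
    ψ = proj₁ (separating-character w w≉1)
    ψw≉1 = proj₂ (separating-character w w≉1)

  characterSum-≈1 : ∀ w → w ≈* 1* → characterSum w KR.≈ ofℕ m
  characterSum-≈1 w w≈1 = sum-ones (λ i → KR.trans (χ-cong (𝕄 i) _ _ w≈1) (χ-one (𝕄 i)))

  characterSum-resp : Respects* characterSum
  characterSum-resp x≈y = sum-cong-≋ {m} (λ i → χ-resp (𝕄 i) x≈y)

  -- Only up to double negation: a point where a nontrivial character is ≉ 1 cannot be found, as 𝕂 has no
  -- decidable equality. The double negation is discharged in characters-count, whose statement is decidable.
  fieldSum-vanishes : ∀ i → i ≢ index 𝟙 → ¬ ¬ fieldSum (𝕄 i) KR.≈ KR.0#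
  fieldSum-vanishes i i≢i₀ sum≉0 = ¬¬-trivial λ trivial → i≢i₀ (≡.sym (index-unique λ x → begin
    KR.1#                                         ≈⟨ trivial (proj₁ (enum*-surjective x)) ⟨
    χ (𝕄 i) (enum* (proj₁ (enum*-surjective x)))  ≈⟨ χ-resp (𝕄 i) (proj₂ (enum*-surjective x)) ⟩
    χ (𝕄 i) x                                     ∎))
    where
    ¬¬-trivial : ¬ ¬ (∀ j → χ (𝕄 i) (enum* j) KR.≈ KR.1#)
    ¬¬-trivial = sequence ¬¬-applicative λ j → sum≉0 ∘ fieldSum-nontrivial (𝕄 i) (enum* j)

  double-count : (∀ i → i ≢ index 𝟙 → fieldSum (𝕄 i) KR.≈ KR.0#) → ofℕ m KR.≈ ofℕ (F.q ∸ 1)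
  double-count vanish = begin
    ofℕ m
      ≈⟨ characterSum-≈1 1* FR.refl ⟨
    characterSum 1*
      ≈⟨ characterSum-resp (enum-code FR.1#) ⟨
    characterSum (F.enum (code FR.1#) , enum-1≉0)
      ≈⟨ extend-nonzero characterSum-resp enum-1≉0 ⟨
    extend characterSum (F.enum (code FR.1#))
      ≈⟨ sum-single (code FR.1#) off-1 ⟨
    sum (λ j → extend characterSum (F.enum j))
      ≈⟨ sum-cong-≋ {F.q} (λ j → extend-sum (λ i → χ (𝕄 i)) (F.enum j)) ⟩
    sum (λ j → sum (λ i → extend (χ (𝕄 i)) (F.enum j)))
      ≈⟨ ∑-comm (λ j i → extend (χ (𝕄 i)) (F.enum j)) ⟩
    sum (λ i → fieldSum (𝕄 i))
      ≈⟨ sum-single (index 𝟙) vanish ⟩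
    fieldSum (𝕄 (index 𝟙))
      ≈⟨ fieldSum-trivial (𝕄 (index 𝟙)) (λ x → KR.sym (index-spec 𝟙 x)) ⟩
    ofℕ (F.q ∸ 1) ∎
    where
    enum-1≉0 : ¬ F.enum (code FR.1#) FR.≈ FR.0#
    enum-1≉0 enum-1≈0 = F.0≉1 (FR.trans (FR.sym enum-1≈0) (enum-code FR.1#))
    off-1 : ∀ j → j ≢ code FR.1# → extend characterSum (F.enum j) KR.≈ KR.0#
    off-1 j j≢code1 = at (F.enum j F.≟ FR.0#)
      where
      at : Dec (F.enum j FR.≈ FR.0#) → extend characterSum (F.enum j) KR.≈ KR.0#
      at (yes enum-j≈0) = extend-zero characterSum enum-j≈0
      at (no enum-j≉0)  = KR.trans (extend-nonzero characterSum-resp enum-j≉0)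
                           (characterSum-≉1 _ λ enum-j≈1 →
                             j≢code1 (F.enum-inj _ _ (FR.trans enum-j≈1 (FR.sym (enum-code FR.1#)))))

  characters-count : m ≡ F.q ∸ 1
  characters-count = decidable-stable (m Nat.≟ F.q ∸ 1) (¬¬-map (ofℕ-injective ∘ double-count) ¬¬-vanish)
    where
    vanishes-off : ∀ i → ¬ ¬ (i ≢ index 𝟙 → fieldSum (𝕄 i) KR.≈ KR.0#)
    vanishes-off i with i Fin.≟ index 𝟙
    ... | yes i≡i₀ = λ ¬vanish → ¬vanish λ i≢i₀ → contradiction i≡i₀ i≢i₀
    ... | no i≢i₀  = ¬¬-map (λ sum≈0 _ → sum≈0) (fieldSum-vanishes i i≢i₀)
    ¬¬-vanish : ¬ ¬ (∀ i → i ≢ index 𝟙 → fieldSum (𝕄 i) KR.≈ KR.0#)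
    ¬¬-vanish = sequence ¬¬-applicative vanishes-off

module JacobiSums {c ℓ c' ℓ' : Level} (𝔽 : FiniteField c ℓ) (𝕂 : ACF₀ c' ℓ') where
  open Characters 𝔽 𝕂
  open CharacterGroup 𝔽 𝕂
  open Complement F.cring
  open RingOps K.cring using (ofℕ)
  open FiniteSums K.cring

  Generic : FR.Carrier → Set ℓ
  Generic a = ¬ a FR.≈ FR.0# × ¬ 1- a FR.≈ FR.0#

  generic? : ∀ a → Dec (Generic a)
  generic? a = ¬? (a F.≟ FR.0#) ×-dec ¬? ((1- a) F.≟ FR.0#)

  Jterm-generic : ∀ ψ φ {a} (a≉0 : ¬ a FR.≈ FR.0#) (1-a≉0 : ¬ 1- a FR.≈ FR.0#) →
                  Jterm (χ ψ) (χ φ) a KR.≈ χ ψ (a , a≉0) KR.* χ φ (1- a , 1-a≉0)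
  Jterm-generic ψ φ {a} a≉0 1-a≉0 with a F.≟ FR.0# | (1- a) F.≟ FR.0#
  ... | yes a≈0 | _         = contradiction a≈0 a≉0
  ... | no _    | yes 1-a≈0 = contradiction 1-a≈0 1-a≉0
  ... | no _    | no _      = KR.*-cong (χ-resp ψ FR.refl) (χ-resp φ FR.refl)

  Jterm-degenerate : ∀ {f g a} → ¬ Generic a → Jterm f g a KR.≈ KR.0#
  Jterm-degenerate {f} {g} {a} ¬generic with a F.≟ FR.0# | (1- a) F.≟ FR.0#
  ... | yes _   | _       = KR.refl
  ... | no _    | yes _   = KR.refl
  ... | no a≉0  | no 1-a≉0 = contradiction (a≉0 , 1-a≉0) ¬generic

  𝕁-as-sum : ∀ f g → 𝕁 f g KR.≈ inv[q-1] KR.* sum (λ x → Jterm f g (F.enum x))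
  𝕁-as-sum f g = KR.*-congˡ (KR.reflexive (∑≡sum F.q (λ x → Jterm f g (F.enum x))))

  ofℕ[q-1]-inverse : ∀ {n} → n ≡ F.q ∸ 1 → inv[q-1] KR.* ofℕ n KR.≈ KR.1#
  ofℕ[q-1]-inverse ≡.refl = KR.trans (KR.*-comm _ _) (proj₂ (K.inverse (ofℕ (F.q ∸ 1)) q-1≉0))

  module Convolution (m : ℕ) (𝕄 : Fin m → Character) (𝕄-enumerates : EnumeratesCharacters m 𝕄)
           (α₁ α₂ α₃ α₄ : Character) where
    open Orthogonality 𝔽 𝕂 m 𝕄 𝕄-enumerates using (characterSum; characterSum-≉1; characterSum-≈1)
    J₁ J₂ : Fin m → FR.Carrier → KR.Carrier
    J₁ i = Jterm (χ (α₁ ·ᶜ 𝕄 i)) (χ (α₂ ·ᶜ 𝕄 i ⁻¹ᶜ))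
    J₂ i = Jterm (χ (α₃ ·ᶜ 𝕄 i)) (χ (α₄ ·ᶜ 𝕄 i ⁻¹ᶜ))

    J₀ : FR.Carrier → KR.Carrier
    J₀ = Jterm (χ (α₁ ·ᶜ α₄)) (χ (α₂ ·ᶜ α₃))

    pairSum : FR.Carrier → FR.Carrier → KR.Carrier
    pairSum a b = sum (λ i → J₁ i a KR.* J₂ i b)

    module GenericPair {a b} (a≉0 : ¬ a FR.≈ FR.0#) (1-a≉0 : ¬ 1- a FR.≈ FR.0#)
                             (b≉0 : ¬ b FR.≈ FR.0#) (1-b≉0 : ¬ 1- b FR.≈ FR.0#) where
      A U B V : F*
      A = a , a≉0
      U = 1- a , 1-a≉0
      B = b , b≉0
      V = 1- b , 1-b≉0

      w : F*
      w = (A ·* B) ·* ((U ·* V) ⁻¹*)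

      C : KR.Carrier
      C = (χ α₁ A KR.* χ α₂ U) KR.* (χ α₃ B KR.* χ α₄ V)

      pairSum≈ : pairSum a b KR.≈ C KR.* characterSum w
      pairSum≈ = begin
        sum (λ i → J₁ i a KR.* J₂ i b)
          ≈⟨ sum-cong-≋ {m} (λ i → KR.*-cong (Jterm-generic (α₁ ·ᶜ 𝕄 i) (α₂ ·ᶜ 𝕄 i ⁻¹ᶜ) a≉0 1-a≉0)
                                             (Jterm-generic (α₃ ·ᶜ 𝕄 i) (α₄ ·ᶜ 𝕄 i ⁻¹ᶜ) b≉0 1-b≉0)) ⟩
        sum (λ i → ((χ α₁ A KR.* χ (𝕄 i) A) KR.* (χ α₂ U KR.* χ (𝕄 i) (U ⁻¹*)))
                   KR.* ((χ α₃ B KR.* χ (𝕄 i) B) KR.* (χ α₄ V KR.* χ (𝕄 i) (V ⁻¹*))))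
          ≈⟨ sum-cong-≋ {m} (λ i → KR.trans (solve 8 (λ a₁ s a₂ s′ a₃ t a₄ t′ →
                   ((a₁ ⊕ s) ⊕ (a₂ ⊕ s′)) ⊕ ((a₃ ⊕ t) ⊕ (a₄ ⊕ t′))
                 ⊜ ((a₁ ⊕ a₂) ⊕ (a₃ ⊕ a₄)) ⊕ ((s ⊕ t) ⊕ (s′ ⊕ t′)))
                 KR.refl _ _ _ _ _ _ _ _) (KR.*-congˡ (KR.sym (χ-quotient (𝕄 i) A B U V)))) ⟩
        sum (λ i → C KR.* χ (𝕄 i) w)
          ≈⟨ *-distribˡ-sum C (λ i → χ (𝕄 i) w) ⟨
        C KR.* characterSum w ∎
        where
        open SetoidReasoning KR.setoid
        open CommutativeMonoidSolver KR.*-commutativeMonoid using (solve; _⊕_; _⊜_)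

      w≈1⇒b≈1-a : w ≈* 1* → b FR.≈ 1- a
      w≈1⇒b≈1-a w≈1 = ab≈[1-a][1-b]⇒b≈1-a (x∙y⁻¹≈ε⇒x≈y (A ·* B) (U ·* V) w≈1)
        where open import Algebra.Properties.Group (AbelianGroup.group F*-abelianGroup) using (x∙y⁻¹≈ε⇒x≈y)

      b≈1-a⇒w≈1 : b FR.≈ 1- a → w ≈* 1*
      b≈1-a⇒w≈1 b≈1-a = x≈y⇒x∙y⁻¹≈ε {A ·* B} {U ·* V} (begin
        a FR.* b                  ≈⟨ FR.*-congˡ b≈1-a ⟩
        a FR.* 1- a               ≈⟨ FR.*-comm a (1- a) ⟩
        1- a FR.* a               ≈⟨ FR.*-congˡ (FR.trans (FR.+-congˡ (FR.-‿cong b≈1-a)) (1-[1-a]≈a a)) ⟨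
        1- a FR.* 1- b            ∎)
        where
        open SetoidReasoning FR.setoid
        open import Algebra.Properties.Group (AbelianGroup.group F*-abelianGroup) using (x≈y⇒x∙y⁻¹≈ε)

    pairSum-offDiagonal : ∀ {a b} → Generic a → ¬ b FR.≈ 1- a → pairSum a b KR.≈ KR.0#
    pairSum-offDiagonal {a} {b} (a≉0 , 1-a≉0) b≉1-a with generic? b
    ... | no b-degenerate = sum-zero {m} λ i →
            KR.trans (KR.*-congˡ (Jterm-degenerate b-degenerate)) (KR.zeroʳ _)
    ... | yes (b≉0 , 1-b≉0) =
            KR.trans pairSum≈ (KR.trans (KR.*-congˡ (characterSum-≉1 w (b≉1-a ∘ w≈1⇒b≈1-a))) (KR.zeroʳ C))
      where open GenericPair a≉0 1-a≉0 b≉0 1-b≉0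

    pairSum-diagonal : ∀ {a b} → Generic a → b FR.≈ 1- a → pairSum a b KR.≈ ofℕ m KR.* J₀ a
    pairSum-diagonal {a} {b} (a≉0 , 1-a≉0) b≈1-a = begin
      pairSum a b
        ≈⟨ pairSum≈ ⟩
      C KR.* characterSum w
        ≈⟨ KR.*-congˡ (characterSum-≈1 w (b≈1-a⇒w≈1 b≈1-a)) ⟩
      C KR.* ofℕ m
        ≈⟨ KR.*-comm C (ofℕ m) ⟩
      ofℕ m KR.* C
        ≈⟨ KR.*-congˡ (KR.*-congˡ (KR.*-cong (χ-resp α₃ b≈1-a) (χ-resp α₄ 1-b≈a))) ⟩
      ofℕ m KR.* ((χ α₁ A KR.* χ α₂ U) KR.* (χ α₃ U KR.* χ α₄ A))
        ≈⟨ KR.*-congˡ (solve 4 (λ x y z t → (x ⊕ y) ⊕ (z ⊕ t) ⊜ (x ⊕ t) ⊕ (y ⊕ z)) KR.refl _ _ _ _) ⟩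
      ofℕ m KR.* ((χ α₁ A KR.* χ α₄ A) KR.* (χ α₂ U KR.* χ α₃ U))
        ≈⟨ KR.*-congˡ (Jterm-generic (α₁ ·ᶜ α₄) (α₂ ·ᶜ α₃) a≉0 1-a≉0) ⟨
      ofℕ m KR.* J₀ a ∎
      where
      1-b≈a : 1- b FR.≈ a
      1-b≈a = FR.trans (FR.+-congˡ (FR.-‿cong b≈1-a)) (1-[1-a]≈a a)
      open GenericPair a≉0 1-a≉0 (1-a≉0 ∘ FR.trans (FR.sym b≈1-a)) (a≉0 ∘ FR.trans (FR.sym 1-b≈a))
      open SetoidReasoning KR.setoid
      open CommutativeMonoidSolver KR.*-commutativeMonoid using (solve; _⊕_; _⊜_)

    sum-pairSum : ∀ a → sum (λ y → pairSum a (F.enum y)) KR.≈ ofℕ m KR.* J₀ a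
    sum-pairSum a with generic? a
    ... | yes a-generic =
      KR.trans (sum-single (code (1- a)) off-diagonal) (pairSum-diagonal a-generic (enum-code (1- a)))
      where
      off-diagonal : ∀ y → y ≢ code (1- a) → pairSum a (F.enum y) KR.≈ KR.0#
      off-diagonal y y≢ = pairSum-offDiagonal a-generic λ enum-y≈1-a →
                            y≢ (F.enum-inj _ _ (FR.trans enum-y≈1-a (FR.sym (enum-code (1- a)))))
    ... | no a-degenerate = begin
      sum (λ y → pairSum a (F.enum y))   ≈⟨ sum-zero {F.q} (λ y → sum-zero {m} λ i → KR.trans
                                              (KR.*-congʳ (Jterm-degenerate a-degenerate))
                                              (KR.zeroˡ _)) ⟩
      KR.0#                              ≈⟨ KR.zeroʳ (ofℕ m) ⟨
      ofℕ m KR.* KR.0#                   ≈⟨ KR.*-congˡ (Jterm-degenerate a-degenerate) ⟨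
      ofℕ m KR.* J₀ a                    ∎
      where open SetoidReasoning KR.setoid

    S₁ S₂ : Fin m → KR.Carrier
    S₁ i = sum (λ x → J₁ i (F.enum x))
    S₂ i = sum (λ y → J₂ i (F.enum y))

    sum-S₁S₂ : sum (λ i → S₁ i KR.* S₂ i) KR.≈ sum (λ x → sum (λ y → pairSum (F.enum x) (F.enum y)))
    sum-S₁S₂ = begin
      sum (λ i → S₁ i KR.* S₂ i)
        ≈⟨ sum-cong-≋ {m} (λ i → sum-*-sum (J₁ i ∘ F.enum) (J₂ i ∘ F.enum)) ⟩
      sum (λ i → sum (λ x → sum (λ y → J₁ i (F.enum x) KR.* J₂ i (F.enum y))))
        ≈⟨ ∑-comm (λ i x → sum (λ y → J₁ i (F.enum x) KR.* J₂ i (F.enum y))) ⟩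
      sum (λ x → sum (λ i → sum (λ y → J₁ i (F.enum x) KR.* J₂ i (F.enum y))))
        ≈⟨ sum-cong-≋ {F.q} (λ x → ∑-comm (λ i y → J₁ i (F.enum x) KR.* J₂ i (F.enum y))) ⟩
      sum (λ x → sum (λ y → pairSum (F.enum x) (F.enum y))) ∎
      where open SetoidReasoning KR.setoid

proposition3p2 : {c ℓ c' ℓ' : Level} (𝔽 : FiniteField c ℓ) (𝕂 : ACF₀ c' ℓ') →
    let open Characters 𝔽 𝕂 in
    let open RingOps K.cring in
    (m : ℕ) (𝕄 : Fin m → Character) → EnumeratesCharacters m 𝕄 →
    (α₁ α₂ α₃ α₄ : Character) →
    ∑ m (λ i → 𝕁 (χ α₁ ⊗ χ (𝕄 i)) (χ α₂ ⊗ inv (χ (𝕄 i)))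
    KR.* 𝕁 (χ α₃ ⊗ χ (𝕄 i)) (χ α₄ ⊗ inv (χ (𝕄 i))))
    KR.≈ 𝕁 (χ α₁ ⊗ χ α₄) (χ α₂ ⊗ χ α₃)
proposition3p2 𝔽 𝕂 m 𝕄 𝕄-enumerates α₁ α₂ α₃ α₄ = begin
  ∑ m (λ i → 𝕁₁ i KR.* 𝕁₂ i)
    ≡⟨ ∑≡sum m (λ i → 𝕁₁ i KR.* 𝕁₂ i) ⟩
  sum (λ i → 𝕁₁ i KR.* 𝕁₂ i)
    ≈⟨ sum-cong-≋ {m} (λ i → KR.*-cong (𝕁-as-sum _ _) (𝕁-as-sum _ _)) ⟩
  sum (λ i → (ι KR.* S₁ i) KR.* (ι KR.* S₂ i))
    ≈⟨ sum-cong-≋ {m} (λ i → solve 3 (λ x s t → (x ⊕ s) ⊕ (x ⊕ t) ⊜ (x ⊕ x) ⊕ (s ⊕ t)) KR.refl ι (S₁ i) (S₂ i)) ⟩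
  sum (λ i → (ι KR.* ι) KR.* (S₁ i KR.* S₂ i))
    ≈⟨ *-distribˡ-sum (ι KR.* ι) (λ i → S₁ i KR.* S₂ i) ⟨
  (ι KR.* ι) KR.* sum (λ i → S₁ i KR.* S₂ i)
    ≈⟨ KR.*-congˡ sum-S₁S₂ ⟩
  (ι KR.* ι) KR.* sum (λ x → sum (λ y → pairSum (F.enum x) (F.enum y)))
    ≈⟨ KR.*-congˡ (sum-cong-≋ {F.q} (λ x → sum-pairSum (F.enum x))) ⟩
  (ι KR.* ι) KR.* sum (λ x → ofℕ m KR.* J₀ (F.enum x))
    ≈⟨ KR.*-congˡ (*-distribˡ-sum (ofℕ m) (J₀ ∘ F.enum)) ⟨
  (ι KR.* ι) KR.* (ofℕ m KR.* sum (J₀ ∘ F.enum))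
    ≈⟨ solve 3 (λ x n s → (x ⊕ x) ⊕ (n ⊕ s) ⊜ x ⊕ ((x ⊕ n) ⊕ s)) KR.refl ι (ofℕ m) _ ⟩
  ι KR.* ((ι KR.* ofℕ m) KR.* sum (J₀ ∘ F.enum))
    ≈⟨ KR.*-congˡ (KR.trans (KR.*-congʳ (ofℕ[q-1]-inverse characters-count)) (KR.*-identityˡ _)) ⟩
  ι KR.* sum (J₀ ∘ F.enum)
    ≈⟨ 𝕁-as-sum _ _ ⟨
  𝕁 (χ α₁ ⊗ χ α₄) (χ α₂ ⊗ χ α₃) ∎
  where
  open Characters 𝔽 𝕂
  open RingOps K.cring
  open FiniteSums K.cring
  open JacobiSums 𝔽 𝕂
  open Convolution m 𝕄 𝕄-enumerates α₁ α₂ α₃ α₄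
  open Orthogonality 𝔽 𝕂 m 𝕄 𝕄-enumerates using (characters-count)
  open SetoidReasoning KR.setoid
  open CommutativeMonoidSolver KR.*-commutativeMonoid using (solve; _⊕_; _⊜_)
  ι = inv[q-1]
  𝕁₁ 𝕁₂ : Fin m → KR.Carrier
  𝕁₁ i = 𝕁 (χ α₁ ⊗ χ (𝕄 i)) (χ α₂ ⊗ inv (χ (𝕄 i)))
  𝕁₂ i = 𝕁 (χ α₃ ⊗ χ (𝕄 i)) (χ α₄ ⊗ inv (χ (𝕄 i)))
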